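{- For hypercubes, $\mathrm{nim}(\mathrm{GEN}(Q_{n}))=0$.
   Context: For $n\ge 2$, the hypercube graph $Q_n$ has vertex set $\{0,1\}^n$ (binary strings of length $n$), with two strings adjacent exactly when they differ in a single digit. For a graph $G=(V,E)$, a set of vertices is geodetically convex if it contains every vertex on every shortest path between two of its vertices; the convex hull $[P]$ is the smallest convex set containing $P$, and $P$ is generating if $[P]=V$. In the achievement game $\mathrm{GEN}(G)$, two players alternately select previously-unselected vertices; the game ends as soon as the selected set generates, and the last player to move wins. $\mathrm{nim}$ denotes the nim-number of an impartial game. -}

module Defs where

open import Level using (Level; _⊔_) renaming (suc to lsuc; zero to lzero)
open import Data.Nat using (ℕ; zero; suc; _+_; _≤_; _<_)
open import Data.Bool using (Bool; true; false)
open import Data.Vec using (Vec; []; _∷_)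
open import Data.List using (List; []; _∷_)
open import Data.List.Membership.Propositional using (_∈_; _∉_)
open import Data.Product using (Σ; _×_; _,_)
open import Relation.Binary.PropositionalEquality using (_≡_; _≢_)
open import Relation.Nullary using (¬_)
open import Data.Bool using (_≟_)
open import Relation.Nullary.Decidable using (does)

Vertex : ℕ → Set
Vertex n = Vec Bool n

diffCount : ∀ {n} → Vertex n → Vertex n → ℕ
diffCount [] [] = 0
diffCount (a ∷ x) (b ∷ y) with does (a ≟ b)
... | true  = diffCount x y
... | false = suc (diffCount x y)

record Adj {n : ℕ} (x y : Vertex n) : Set where
  constructor adj
  field differsInOne : diffCount x y ≡ 1

data Walk {n : ℕ} : Vertex n → Vertex n → Set where
  stop : ∀ {u} → Walk u u
  step : ∀ {u w v} → Adj u w → Walk w v → Walk u v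

walkLength : ∀ {n} {u v : Vertex n} → Walk u v → ℕ
walkLength stop = 0
walkLength (step _ p) = suc (walkLength p)

data OnWalk {n : ℕ} (x : Vertex n) : {u v : Vertex n} → Walk u v → Set where
  here  : ∀ {v} {p : Walk x v} → OnWalk x p
  there : ∀ {u w v} {a : Adj u w} {p : Walk w v} → OnWalk x p → OnWalk x (step a p)

Shortest : ∀ {n} {u v : Vertex n} → Walk u v → Set
Shortest {u = u} {v} p = (q : Walk u v) → walkLength p ≤ walkLength q

VSet : ℕ → Set₁
VSet n = Vertex n → Set

Convex : ∀ {n} → VSet n → Set
Convex {n} S = (u v : Vertex n) → S u → S v → (p : Walk u v) → Shortest p →
               (x : Vertex n) → OnWalk x p → S x

-- P is generating: its convex hull (the smallest convex set containing P,
-- i.e. the intersection of all convex sets containing P) is all of V.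
Generating : ∀ {n} → List (Vertex n) → Set₁
Generating {n} P = (S : VSet n) → Convex S → ((x : Vertex n) → x ∈ P → S x) →
                   (x : Vertex n) → S x

-- A position is the list of selected
-- vertices.
-- Terminal positions (selected set generates) have nim-number 0; otherwise the
-- nim-number is the mex of the nim-numbers of the options P ∪ {v}, v ∉ P.
data NimVal {n : ℕ} : List (Vertex n) → ℕ → Set₁ where
  terminal : ∀ {P} → Generating P → NimVal P 0
  move : ∀ {P k} → ¬ Generating P →
         ((j : ℕ) → j < k → Σ (Vertex n) λ v → v ∉ P × NimVal (v ∷ P) j) →
         ((v : Vertex n) → v ∉ P → Σ ℕ λ j → NimVal (v ∷ P) j × j ≢ k) →
         NimVal P k

NimGEN : ℕ → ℕ → Set₁
NimGEN n k = NimVal {n} [] k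

{-# OPTIONS --safe #-}
module Submission where

-- A list of vertices of Q_n generates iff it meets every half-cube {x | x_i = b}. The complement
-- of a half-cube is convex, since a path leaving and re-entering it is two steps longer than a
-- geodesic. Conversely, a convex set containing such a list reaches any target t by fixing one
-- disagreeing digit at a time: the corrected vertex lies on a geodesic between the current vertex
-- and a vertex of the list carrying t's digit. Hence no single vertex generates while a vertex
-- together with its antipode does, so after any first move the antipode is a winning reply, every
-- option of the empty position has nonzero nim-number, and the game has nim-number 0. The
-- criterion also makes generation decidable, which is what lets every position have a nim-number.

open import Defs
open import Algebra.Properties.CommutativeSemigroup using (interchange)
open import Data.Bool using (Bool; true; false; not; _≟_)
open import Data.Bool.Properties using (not-¬; ¬-not)
open import Data.Empty using (⊥; ⊥-elim)
open import Data.Fin using (Fin; zero; suc)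
open import Data.Fin.Properties using (all?)
open import Data.List using (List; []; _∷_; _++_; map; filter; length)
open import Data.List.Extrema.Nat using (max; xs≤max)
open import Data.List.Membership.Propositional using (_∈_; _∉_; mapWith∈; find; lose)
open import Data.List.Membership.Propositional.Properties
  using (∈-map⁺; ∈-++⁺ˡ; ∈-++⁺ʳ; ∈-filter⁺; ∈-filter⁻)
open import Data.List.Properties using (filter-notAll)
import Data.List.Relation.Unary.All as All
open import Data.List.Relation.Unary.Any as Any using (Any; here; there; any?)
open import Data.List.Relation.Unary.Any.Properties using (mapWith∈⁺; mapWith∈⁻)
open import Data.Nat using (ℕ; zero; suc; _+_; _≤_; _<_; z≤n; s≤s)
open import Data.Nat.Properties
  using ( ≤-reflexive; ≤-trans; <⇒≱; n≤1+n; n<1+n; 1+n≰n; m<1+n⇒m<n∨m≡n; suc-injective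
        ; +-identityʳ; +-mono-≤; +-monoˡ-≤; +-monoʳ-≤; +-mono-≤-<; +-commutativeSemigroup
        ; module ≤-Reasoning )
import Data.Nat.Properties as ℕ
open import Data.List.Membership.DecPropositional ℕ._≟_ using (_∈?_)
open import Data.Nat.Induction using (<-wellFounded)
open import Data.Product using (Σ; ∃; _×_; _,_; proj₁; proj₂)
open import Data.Sum using (_⊎_; inj₁; inj₂)
open import Data.Vec using ([]; _∷_; lookup; _[_]≔_; replicate) renaming (map to vmap)
open import Data.Vec.Properties using (≡-dec; lookup-replicate; lookup-map)
open import Function.Base using (_∘_)
open import Function.Bundles using (_⇔_; mk⇔; Equivalence)
open import Induction.WellFounded using (Acc; acc)
open import Relation.Nullary using (¬_; Dec; yes; no; ¬?; _×-dec_)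
open import Relation.Nullary.Decidable using (map′)
open import Relation.Binary.PropositionalEquality

open ≤-Reasoning hiding (stop)

diffBit : Bool → Bool → ℕ
diffBit true  true  = 0
diffBit false false = 0
diffBit true  false = 1
diffBit false true  = 1

diffBit-self : ∀ a → diffBit a a ≡ 0
diffBit-self true  = refl
diffBit-self false = refl

diffBit-≢ : ∀ {a b} → a ≢ b → diffBit a b ≡ 1
diffBit-≢ {true}  {true}  a≢b = ⊥-elim (a≢b refl)
diffBit-≢ {false} {false} a≢b = ⊥-elim (a≢b refl)
diffBit-≢ {true}  {false} _   = refl
diffBit-≢ {false} {true}  _   = refl

diffBit-triangle : ∀ a b c → diffBit a c ≤ diffBit a b + diffBit b c
diffBit-triangle true  true  true  = z≤n
diffBit-triangle true  true  false = s≤s z≤n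
diffBit-triangle true  false true  = z≤n
diffBit-triangle true  false false = s≤s z≤n
diffBit-triangle false true  true  = s≤s z≤n
diffBit-triangle false true  false = z≤n
diffBit-triangle false false true  = s≤s z≤n
diffBit-triangle false false false = z≤n

diffCount-∷ : ∀ {n} a b (x y : Vertex n) → diffCount (a ∷ x) (b ∷ y) ≡ diffBit a b + diffCount x y
diffCount-∷ true  true  x y = refl
diffCount-∷ true  false x y = refl
diffCount-∷ false true  x y = refl
diffCount-∷ false false x y = refl

diffCount-self : ∀ {n} (x : Vertex n) → diffCount x x ≡ 0
diffCount-self []          = refl
diffCount-self (true  ∷ x) = diffCount-self x
diffCount-self (false ∷ x) = diffCount-self x

diffCount≡0⇒≡ : ∀ {n} (x y : Vertex n) → diffCount x y ≡ 0 → x ≡ y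
diffCount≡0⇒≡ []          []          _ = refl
diffCount≡0⇒≡ (true  ∷ x) (true  ∷ y) e = cong (true ∷_) (diffCount≡0⇒≡ x y e)
diffCount≡0⇒≡ (false ∷ x) (false ∷ y) e = cong (false ∷_) (diffCount≡0⇒≡ x y e)

diffCount≡suc⇒differ : ∀ {n k} (x y : Vertex n) → diffCount x y ≡ suc k →
                       ∃ λ i → lookup x i ≢ lookup y i
diffCount≡suc⇒differ [] [] ()
diffCount≡suc⇒differ (true  ∷ x) (false ∷ y) _ = zero , λ ()
diffCount≡suc⇒differ (false ∷ x) (true  ∷ y) _ = zero , λ ()
diffCount≡suc⇒differ (true  ∷ x) (true  ∷ y) e =
  let i , xᵢ≢yᵢ = diffCount≡suc⇒differ x y e in suc i , xᵢ≢yᵢ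
diffCount≡suc⇒differ (false ∷ x) (false ∷ y) e =
  let i , xᵢ≢yᵢ = diffCount≡suc⇒differ x y e in suc i , xᵢ≢yᵢ

diffCount-∷-+ : ∀ {n} a b c (x y z : Vertex n) →
                diffCount (a ∷ x) (b ∷ y) + diffCount (b ∷ y) (c ∷ z) ≡
                (diffBit a b + diffBit b c) + (diffCount x y + diffCount y z)
diffCount-∷-+ a b c x y z =
  trans (cong₂ _+_ (diffCount-∷ a b x y) (diffCount-∷ b c y z))
        (interchange +-commutativeSemigroup (diffBit a b) (diffCount x y) (diffBit b c) (diffCount y z))

diffCount-triangle : ∀ {n} (x y z : Vertex n) → diffCount x z ≤ diffCount x y + diffCount y z
diffCount-triangle []      []      []      = z≤n
diffCount-triangle (a ∷ x) (b ∷ y) (c ∷ z) = begin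
  diffCount (a ∷ x) (c ∷ z)
    ≡⟨ diffCount-∷ a c x z ⟩
  diffBit a c + diffCount x z
    ≤⟨ +-mono-≤ (diffBit-triangle a b c) (diffCount-triangle x y z) ⟩
  (diffBit a b + diffBit b c) + (diffCount x y + diffCount y z)
    ≡⟨ diffCount-∷-+ a b c x y z ⟨
  diffCount (a ∷ x) (b ∷ y) + diffCount (b ∷ y) (c ∷ z)
    ∎

diffCount-update : ∀ {n} (x y : Vertex n) (i : Fin n) →
                   diffCount x (x [ i ]≔ lookup y i) + diffCount (x [ i ]≔ lookup y i) y ≡ diffCount x y
diffCount-update (a ∷ x) (b ∷ y) zero = begin-equality
  diffCount (a ∷ x) (b ∷ x) + diffCount (b ∷ x) (b ∷ y)
    ≡⟨ diffCount-∷-+ a b b x x y ⟩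
  (diffBit a b + diffBit b b) + (diffCount x x + diffCount x y)
    ≡⟨ cong₂ (λ m k → (diffBit a b + m) + (k + diffCount x y)) (diffBit-self b) (diffCount-self x) ⟩
  (diffBit a b + 0) + diffCount x y
    ≡⟨ cong (_+ diffCount x y) (+-identityʳ (diffBit a b)) ⟩
  diffBit a b + diffCount x y
    ≡⟨ diffCount-∷ a b x y ⟨
  diffCount (a ∷ x) (b ∷ y)
    ∎
diffCount-update (a ∷ x) (b ∷ y) (suc i) = begin-equality
  diffCount (a ∷ x) (a ∷ x′) + diffCount (a ∷ x′) (b ∷ y)
    ≡⟨ diffCount-∷-+ a a b x x′ y ⟩
  (diffBit a a + diffBit a b) + (diffCount x x′ + diffCount x′ y)
    ≡⟨ cong (λ k → (k + diffBit a b) + (diffCount x x′ + diffCount x′ y)) (diffBit-self a) ⟩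
  diffBit a b + (diffCount x x′ + diffCount x′ y)
    ≡⟨ cong (diffBit a b +_) (diffCount-update x y i) ⟩
  diffBit a b + diffCount x y
    ≡⟨ diffCount-∷ a b x y ⟨
  diffCount (a ∷ x) (b ∷ y)
    ∎
  where
  x′ : Vertex _
  x′ = x [ i ]≔ lookup y i

diffCount-update-≢ : ∀ {n} (x : Vertex n) (i : Fin n) {b} → lookup x i ≢ b →
                     diffCount x (x [ i ]≔ b) ≡ 1
diffCount-update-≢ (a ∷ x) zero    {b} a≢b =
  trans (diffCount-∷ a b x x) (cong₂ _+_ (diffBit-≢ a≢b) (diffCount-self x))
diffCount-update-≢ (a ∷ x) (suc i) {b} xᵢ≢b =
  trans (diffCount-∷ a a x (x [ i ]≔ b)) (cong₂ _+_ (diffBit-self a) (diffCount-update-≢ x i xᵢ≢b))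

stepTowards : ∀ {n k} (x y : Vertex n) → diffCount x y ≡ suc k →
              ∃ λ i → lookup x i ≢ lookup y i × diffCount (x [ i ]≔ lookup y i) y ≡ k
stepTowards x y d≡1+k =
  let i , xᵢ≢yᵢ = diffCount≡suc⇒differ x y d≡1+k
      x′ = x [ i ]≔ lookup y i
  in i , xᵢ≢yᵢ , suc-injective (begin-equality
       suc (diffCount x′ y)             ≡⟨ cong (_+ diffCount x′ y) (diffCount-update-≢ x i xᵢ≢yᵢ) ⟨
       diffCount x x′ + diffCount x′ y  ≡⟨ diffCount-update x y i ⟩
       diffCount x y                    ≡⟨ d≡1+k ⟩
       suc _                            ∎)

diffCount-detour : ∀ {n} (u v x : Vertex n) (i : Fin n) →
                   lookup u i ≡ lookup v i → lookup x i ≢ lookup u i →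
                   diffCount u v < diffCount u x + diffCount x v
diffCount-detour (true  ∷ u) (true  ∷ v) (true  ∷ x) zero _ xᵢ≢uᵢ = ⊥-elim (xᵢ≢uᵢ refl)
diffCount-detour (false ∷ u) (false ∷ v) (false ∷ x) zero _ xᵢ≢uᵢ = ⊥-elim (xᵢ≢uᵢ refl)
diffCount-detour (true  ∷ u) (true  ∷ v) (false ∷ x) zero _ _ =
  s≤s (≤-trans (diffCount-triangle u x v) (+-monoʳ-≤ _ (n≤1+n _)))
diffCount-detour (false ∷ u) (false ∷ v) (true  ∷ x) zero _ _ =
  s≤s (≤-trans (diffCount-triangle u x v) (+-monoʳ-≤ _ (n≤1+n _)))
diffCount-detour (a ∷ u) (b ∷ v) (c ∷ x) (suc i) uᵢ≡vᵢ xᵢ≢uᵢ = begin-strict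
  diffCount (a ∷ u) (b ∷ v)
    ≡⟨ diffCount-∷ a b u v ⟩
  diffBit a b + diffCount u v
    <⟨ +-mono-≤-< (diffBit-triangle a c b) (diffCount-detour u v x i uᵢ≡vᵢ xᵢ≢uᵢ) ⟩
  (diffBit a c + diffBit c b) + (diffCount u x + diffCount x v)
    ≡⟨ diffCount-∷-+ a c b u x v ⟨
  diffCount (a ∷ u) (c ∷ x) + diffCount (c ∷ x) (b ∷ v)
    ∎

_++ʷ_ : ∀ {n} {u x v : Vertex n} → Walk u x → Walk x v → Walk u v
stop     ++ʷ q = q
step a p ++ʷ q = step a (p ++ʷ q)

walkLength-++ʷ : ∀ {n} {u x v : Vertex n} (p : Walk u x) (q : Walk x v) →
                 walkLength (p ++ʷ q) ≡ walkLength p + walkLength q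
walkLength-++ʷ stop       q = refl
walkLength-++ʷ (step a p) q = cong suc (walkLength-++ʷ p q)

onWalk-++ʷ : ∀ {n} {u x v : Vertex n} (p : Walk u x) (q : Walk x v) → OnWalk x (p ++ʷ q)
onWalk-++ʷ stop       q = here
onWalk-++ʷ (step a p) q = there (onWalk-++ʷ p q)

diffCount≤walkLength : ∀ {n} {u v : Vertex n} (p : Walk u v) → diffCount u v ≤ walkLength p
diffCount≤walkLength {u = u} stop = ≤-reflexive (diffCount-self u)
diffCount≤walkLength {u = u} {v} (step {w = w} (adj u~w) p) = begin
  diffCount u v                 ≤⟨ diffCount-triangle u w v ⟩
  diffCount u w + diffCount w v ≡⟨ cong (_+ diffCount w v) u~w ⟩
  suc (diffCount w v)           ≤⟨ s≤s (diffCount≤walkLength p) ⟩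
  suc (walkLength p)            ∎

onWalk⇒diffCount≤walkLength : ∀ {n} {u v x : Vertex n} {p : Walk u v} → OnWalk x p →
                               diffCount u x + diffCount x v ≤ walkLength p
onWalk⇒diffCount≤walkLength {v = v} {x} {p} here =
  ≤-trans (≤-reflexive (cong (_+ diffCount x v) (diffCount-self x))) (diffCount≤walkLength p)
onWalk⇒diffCount≤walkLength {u = u} {v} {x} (there {w = w} {a = adj u~w} {p} x∈p) = begin
  diffCount u x + diffCount x v
    ≤⟨ +-monoˡ-≤ (diffCount x v) (diffCount-triangle u w x) ⟩
  (diffCount u w + diffCount w x) + diffCount x v
    ≡⟨ cong (λ k → k + diffCount w x + diffCount x v) u~w ⟩
  suc (diffCount w x + diffCount x v)
    ≤⟨ s≤s (onWalk⇒diffCount≤walkLength x∈p) ⟩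
  suc (walkLength p)
    ∎

geodesic : ∀ {n} (u v : Vertex n) → Σ (Walk u v) λ p → walkLength p ≡ diffCount u v
geodesic u v = go (diffCount u v) u refl
  where
  go : ∀ k u → diffCount u v ≡ k → Σ (Walk u v) λ p → walkLength p ≡ k
  go zero    u d≡0 with refl ← diffCount≡0⇒≡ u v d≡0 = stop , refl
  go (suc k) u d≡1+k =
    let i , uᵢ≢vᵢ , d′≡k = stepTowards u v d≡1+k
        p , |p| = go k (u [ i ]≔ lookup v i) d′≡k
    in step (adj (diffCount-update-≢ u i uᵢ≢vᵢ)) p , cong suc |p|

shortest⇒walkLength≤diffCount : ∀ {n} {u v : Vertex n} {p : Walk u v} → Shortest p →
                                walkLength p ≤ diffCount u v
shortest⇒walkLength≤diffCount {u = u} {v} shortest =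
  let q , |q| = geodesic u v in ≤-trans (shortest q) (≤-reflexive |q|)

convex⇒interval : ∀ {n} {S : VSet n} → Convex S → {u v x : Vertex n} → S u → S v →
                  diffCount u x + diffCount x v ≤ diffCount u v → S x
convex⇒interval convex {u} {v} {x} Su Sv between =
  convex u v Su Sv (p ++ʷ q) shortest x (onWalk-++ʷ p q)
  where
  p : Walk u x
  p = proj₁ (geodesic u x)

  q : Walk x v
  q = proj₁ (geodesic x v)

  shortest : Shortest (p ++ʷ q)
  shortest r = begin
    walkLength (p ++ʷ q)          ≡⟨ walkLength-++ʷ p q ⟩
    walkLength p + walkLength q   ≡⟨ cong₂ _+_ (proj₂ (geodesic u x)) (proj₂ (geodesic x v)) ⟩
    diffCount u x + diffCount x v ≤⟨ between ⟩
    diffCount u v                 ≤⟨ diffCount≤walkLength r ⟩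
    walkLength r                  ∎

avoidHalfCube-convex : ∀ {n} (i : Fin n) (b : Bool) → Convex (λ x → lookup x i ≢ b)
avoidHalfCube-convex i b u v uᵢ≢b vᵢ≢b p shortest x x∈p xᵢ≡b =
  <⇒≱ (diffCount-detour u v x i uᵢ≡vᵢ xᵢ≢uᵢ)
      (≤-trans (onWalk⇒diffCount≤walkLength x∈p) (shortest⇒walkLength≤diffCount shortest))
  where
  uᵢ≡vᵢ : lookup u i ≡ lookup v i
  uᵢ≡vᵢ = trans (¬-not uᵢ≢b) (sym (¬-not vᵢ≢b))

  xᵢ≢uᵢ : lookup x i ≢ lookup u i
  xᵢ≢uᵢ xᵢ≡uᵢ = uᵢ≢b (trans (sym xᵢ≡uᵢ) xᵢ≡b)

MeetsAllHalfCubes : ∀ {n} → List (Vertex n) → Set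
MeetsAllHalfCubes {n} P = (i : Fin n) (b : Bool) → Any (λ z → lookup z i ≡ b) P

generating⇒meetsAllHalfCubes : ∀ {n} {P : List (Vertex n)} → Generating P → MeetsAllHalfCubes P
generating⇒meetsAllHalfCubes {n} {P} generating i b with any? (λ z → lookup z i ≟ b) P
... | yes meets = meets
... | no avoids = ⊥-elim (generating (λ x → lookup x i ≢ b) (avoidHalfCube-convex i b)
                                      (λ z z∈P zᵢ≡b → avoids (lose z∈P zᵢ≡b))
                                      (replicate n b) (lookup-replicate i b))

meetsAllHalfCubes⇒generating : ∀ {n} {P : List (Vertex n)} {y : Vertex n} → y ∈ P →
                               MeetsAllHalfCubes P → Generating P
meetsAllHalfCubes⇒generating {y = y} y∈P meets S convex P⊆S t =
  reach (diffCount y t) y (P⊆S y y∈P) refl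
  where
  reach : ∀ k c → S c → diffCount c t ≡ k → S t
  reach zero    c Sc d≡0 = subst S (diffCount≡0⇒≡ c t d≡0) Sc
  reach (suc k) c Sc d≡1+k =
    let i , _ , d′≡k = stepTowards c t d≡1+k
        z , z∈P , zᵢ≡tᵢ = find (meets i (lookup t i))
        Sc′ : S (c [ i ]≔ lookup t i)
        Sc′ = subst (λ b → S (c [ i ]≔ b)) zᵢ≡tᵢ
                    (convex⇒interval convex Sc (P⊆S z z∈P) (≤-reflexive (diffCount-update c z i)))
    in reach k (c [ i ]≔ lookup t i) Sc′ d′≡k

¬generating-[] : ∀ {n} → ¬ Generating {n} []
¬generating-[] {n} generating = generating (λ _ → ⊥) (λ _ _ ()) (λ _ ()) (replicate n false)

meetsAllHalfCubes? : ∀ {n} (P : List (Vertex n)) → Dec (MeetsAllHalfCubes P)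
meetsAllHalfCubes? P = all? λ i →
  map′ (λ (meetsᵗ , meetsᶠ) → λ { true → meetsᵗ ; false → meetsᶠ })
       (λ meets → meets true , meets false)
       (any? (λ z → lookup z i ≟ true) P ×-dec any? (λ z → lookup z i ≟ false) P)

generating? : ∀ {n} (P : List (Vertex n)) → Dec (Generating P)
generating? []      = no ¬generating-[]
generating? (y ∷ P) = map′ (meetsAllHalfCubes⇒generating (here refl)) generating⇒meetsAllHalfCubes
                           (meetsAllHalfCubes? (y ∷ P))

vertices : ∀ n → List (Vertex n)
vertices zero    = [] ∷ []
vertices (suc n) = map (true ∷_) (vertices n) ++ map (false ∷_) (vertices n)

∈-vertices : ∀ {n} (x : Vertex n) → x ∈ vertices n
∈-vertices []                  = here refl
∈-vertices {suc n} (true  ∷ x) = ∈-++⁺ˡ (∈-map⁺ (true ∷_) (∈-vertices x))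
∈-vertices {suc n} (false ∷ x) =
  ∈-++⁺ʳ (map (true ∷_) (vertices n)) (∈-map⁺ (false ∷_) (∈-vertices x))

-- U lists exactly the vertices still available in position P; its length bounds the rest of
-- the game.
Unselected : ∀ {n} → List (Vertex n) → List (Vertex n) → Set
Unselected {n} P U = (w : Vertex n) → w ∉ P ⇔ w ∈ U

remove : ∀ {n} → Vertex n → List (Vertex n) → List (Vertex n)
remove v = filter (λ w → ¬? (≡-dec _≟_ w v))

unselected-[] : ∀ {n} → Unselected [] (vertices n)
unselected-[] w = mk⇔ (λ _ → ∈-vertices w) (λ _ ())

unselected-∷ : ∀ {n} {P U : List (Vertex n)} {v} → Unselected P U → Unselected (v ∷ P) (remove v U)
unselected-∷ unselected w = mk⇔
  (λ w∉v∷P → ∈-filter⁺ _ (Equivalence.to (unselected w) (w∉v∷P ∘ there)) (w∉v∷P ∘ here))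
  (λ w∈U′ → let w∈U , w≢v = ∈-filter⁻ _ w∈U′ in
    λ { (here w≡v) → w≢v w≡v ; (there w∈P) → Equivalence.from (unselected w) w∈U w∈P })

length-remove : ∀ {n} {v : Vertex n} {U} → v ∈ U → length (remove v U) < length U
length-remove v∈U = filter-notAll _ _ (Any.map (λ v≡w w≢v → w≢v (sym v≡w)) v∈U)

Mex : List ℕ → ℕ → Set
Mex xs k = k ∉ xs × (∀ {j} → j < k → j ∈ xs)

mex-below : ∀ b (xs : List ℕ) → (∀ {j} → j < b → j ∈ xs) ⊎ ∃ (Mex xs)
mex-below zero    xs = inj₁ λ ()
mex-below (suc b) xs with mex-below b xs | b ∈? xs
... | inj₂ mex   | _        = inj₂ mex
... | inj₁ below | no  b∉xs = inj₂ (b , b∉xs , below)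
... | inj₁ below | yes b∈xs = inj₁ λ j<1+b → case-split (m<1+n⇒m<n∨m≡n j<1+b)
  where
  case-split : ∀ {j} → j < b ⊎ j ≡ b → j ∈ xs
  case-split (inj₁ j<b)  = below j<b
  case-split (inj₂ refl) = b∈xs

mex : (xs : List ℕ) → ∃ (Mex xs)
mex xs with mex-below (suc (suc (max 0 xs))) xs
... | inj₂ mex   = mex
... | inj₁ below = ⊥-elim (1+n≰n (All.lookup (xs≤max 0 xs) (below (n<1+n _))))

nimVal-fromOptions : ∀ {n} {P U : List (Vertex n)} → ¬ Generating P → Unselected P U →
                     (∀ {w} → w ∈ U → ∃ (NimVal (w ∷ P))) → ∃ (NimVal P)
nimVal-fromOptions {n} {P} {U} ¬generating unselected option = k , move ¬generating lower options
  where
  values : List ℕ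
  values = mapWith∈ U (proj₁ ∘ option)

  k : ℕ
  k = proj₁ (mex values)

  k∉values : k ∉ values
  k∉values = proj₁ (proj₂ (mex values))

  lower : ∀ j → j < k → Σ (Vertex n) λ w → w ∉ P × NimVal (w ∷ P) j
  lower j j<k with w , w∈U , refl ← mapWith∈⁻ U _ (proj₂ (proj₂ (mex values)) j<k) =
    w , Equivalence.from (unselected w) w∈U , proj₂ (option w∈U)

  options : ∀ w → w ∉ P → Σ ℕ λ j → NimVal (w ∷ P) j × j ≢ k
  options w w∉P = let w∈U = Equivalence.to (unselected w) w∉P in
    proj₁ (option w∈U) , proj₂ (option w∈U) ,
    λ j≡k → k∉values (mapWith∈⁺ _ (w , w∈U , sym j≡k))

nimVal-exists : ∀ {n} (P U : List (Vertex n)) → Unselected P U → Acc _<_ (length U) → ∃ (NimVal P)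
nimVal-exists P U unselected (acc smaller) with generating? P
... | yes generating  = 0 , terminal generating
... | no ¬generating = nimVal-fromOptions ¬generating unselected λ {w} w∈U →
  nimVal-exists (w ∷ P) (remove w U) (unselected-∷ unselected) (smaller (length-remove w∈U))

nimVal-generating : ∀ {n} {P : List (Vertex n)} {k} → Generating P → NimVal P k → k ≡ 0
nimVal-generating _          (terminal _)           = refl
nimVal-generating generating (move ¬generating _ _) = ⊥-elim (¬generating generating)

nimVal-winningMove : ∀ {n} {P : List (Vertex n)} {w k} →
                     ¬ Generating P → w ∉ P → Generating (w ∷ P) → NimVal P k → k ≢ 0
nimVal-winningMove ¬generating _   _          (terminal generating) _ = ¬generating generating
nimVal-winningMove _           w∉P generating (move _ _ options) refl =
  let _ , value , value≢0 = options _ w∉P in value≢0 (nimVal-generating generating value)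

antipode : ∀ {n} → Vertex n → Vertex n
antipode = vmap not

¬generating-singleton : ∀ {m} (v : Vertex (suc m)) → ¬ Generating (v ∷ [])
¬generating-singleton v generating
  with here v₀≡¬v₀ ← generating⇒meetsAllHalfCubes generating zero (not (lookup v zero))
  = not-¬ refl v₀≡¬v₀

antipode-∉ : ∀ {m} (v : Vertex (suc m)) → antipode v ∉ v ∷ []
antipode-∉ v (here v̄≡v) =
  not-¬ refl (trans (sym (cong (λ x → lookup x zero) v̄≡v)) (lookup-map zero not v))

generating-antipodal : ∀ {n} (v : Vertex n) → Generating (antipode v ∷ v ∷ [])
generating-antipodal v = meetsAllHalfCubes⇒generating (here refl) meets
  where
  meets : MeetsAllHalfCubes (antipode v ∷ v ∷ [])
  meets i b with lookup v i ≟ b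
  ... | yes vᵢ≡b = there (here vᵢ≡b)
  ... | no  vᵢ≢b = here (trans (lookup-map i not v) (sym (¬-not (vᵢ≢b ∘ sym))))

nimGEN-suc : ∀ m → NimGEN (suc m) 0
nimGEN-suc m = move ¬generating-[] (λ _ ()) options
  where
  options : ∀ v → v ∉ [] → Σ ℕ λ j → NimVal (v ∷ []) j × j ≢ 0
  options v _ =
    let j , value = nimVal-exists (v ∷ []) (remove v (vertices _))
                                  (unselected-∷ unselected-[]) (<-wellFounded _)
    in j , value ,
       nimVal-winningMove (¬generating-singleton v) (antipode-∉ v) (generating-antipodal v) value

proposition7p11 : (n : ℕ) → 2 ≤ n → NimGEN n 0
proposition7p11 zero    ()
proposition7p11 (suc m) _ = nimGEN-suc m
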